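{- Let $\Delta$ be a finite simplicial complex of dimension $d\ge 1$ with Hasse diagram arc set $A$, and let $P_M\subseteq\mathbb{R}^A$ be its Morse matching polytope. For every face $F$ of $\Delta$ with $|\delta(F)| \geq 2$, the inequality $\sum_{a\in\delta(F)} x_a \leq 1$ defines a facet of $P_M$.
   Context: A finite abstract simplicial complex $\Delta$ is a family of nonempty subsets (faces) of a finite set closed under nonempty subsets; $\dim F=|F|-1$, $d=\dim\Delta$; we assume $\Delta$ is connected (its graph is connected). The Hasse diagram $H$ has the faces as nodes and arc set $A$ consisting of arcs $(G,F)$ with $F\subset G$, $\dim F=\dim G-1$. For a face $F$, $\delta(F)\subseteq A$ is the set of arcs incident to $F$. For $i=0,\dots,d-1$, $H_i$ is the subgraph of $H$ (viewed as undirected) consisting of the faces of dimensions $i$ and $i+1$ and the arcs between them, and $\mathcal{C}_i$ is the set of (simple, undirected) cycles in $H_i$. For $S\subseteq A$, $x(S)=\sum_{a\in S}x_a$. The polytope $P_M$ is the convex hull of all $x\in\{0,1\}^A$ satisfying the matching inequalities $x(\delta(F))\le 1$ for all faces $F$ and the cycle inequalities $x(C)\le \tfrac12|C|-1$ for all $C\in\mathcal{C}_i$, $i=0,\dots,d-1$; these are exactly the incidence vectors of Morse matchings (matchings $M\subseteq A$ such that reversing the arcs of $M$ in $H$ yields an acyclic directed graph). -}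

module Defs where

open import Data.Bool using (Bool; true; false; _∧_; _∨_; if_then_else_)
open import Data.Nat as ℕ using (ℕ; zero; suc; _≤_)
open import Data.Fin using (Fin; zero; suc)
open import Data.Fin.Subset as Sub using (Subset; ∣_∣; _⊆_; ⁅_⁆; _∪_)
open import Data.Fin.Subset.Properties using (_⊆?_)
open import Data.Vec using (Vec; []; _∷_)
import Data.Vec.Properties as VecP
import Data.Bool.Properties as BoolP
open import Data.List using (List; []; _∷_; _++_; map; concatMap)
open import Data.Rational as ℚ using (ℚ; 0ℚ; 1ℚ)
open import Data.Product using (Σ; ∃; _×_; _,_)
open import Relation.Nullary using (¬_; Dec; yes; no)
open import Relation.Nullary.Decidable using (⌊_⌋)
open import Relation.Binary.PropositionalEquality using (_≡_; _≢_)
open import Relation.Binary.Construct.Closure.Transitive using (TransClosure)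
open import Relation.Binary.Construct.Closure.ReflexiveTransitive using (Star)

allSubsets : (n : ℕ) → List (Subset n)
allSubsets zero    = [] ∷ []
allSubsets (suc n) = map (true ∷_) (allSubsets n) ++ map (false ∷_) (allSubsets n)

_=ˢ_ : {n : ℕ} → Subset n → Subset n → Bool
F =ˢ G = ⌊ VecP.≡-dec BoolP._≟_ F G ⌋

count : {A : Set} → (A → Bool) → List A → ℕ
count p []       = 0
count p (x ∷ xs) = (if p x then 1 else 0) ℕ.+ count p xs

countPairs : {n : ℕ} → (Subset n → Subset n → Bool) → ℕ
countPairs {n} p = sumL (map (λ G → count (p G) (allSubsets n)) (allSubsets n))
  where
  sumL : List ℕ → ℕ
  sumL []       = 0
  sumL (k ∷ ks) = k ℕ.+ sumL ks

Family : ℕ → Set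
Family n = Subset n → Bool

record IsSimplicialComplex {n : ℕ} (Δ : Family n) : Set where
  field
    nonempty-faces : Δ Sub.⊥ ≡ false
    down-closed    : ∀ G F → Δ G ≡ true → F ⊆ G → F ≢ Sub.⊥ → Δ F ≡ true

GraphEdge : {n : ℕ} → Family n → Fin n → Fin n → Set
GraphEdge Δ i j = (i ≢ j) × (Δ (⁅ i ⁆ ∪ ⁅ j ⁆) ≡ true)

Connected : {n : ℕ} → Family n → Set
Connected Δ = ∀ i j → Δ ⁅ i ⁆ ≡ true → Δ ⁅ j ⁆ ≡ true → Star (GraphEdge Δ) i j

-- dim Δ ≥ 1 : some face has at least two elements
DimAtLeast1 : {n : ℕ} → Family n → Set
DimAtLeast1 Δ = ∃ λ G → (Δ G ≡ true) × (2 ≤ ∣ G ∣)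

-- Hasse diagram: arc (G , F) with F ⊂ G, dim F = dim G - 1

isArc : {n : ℕ} → Family n → Subset n → Subset n → Bool
isArc Δ G F = Δ G ∧ Δ F ∧ ⌊ F ⊆? G ⌋ ∧ ⌊ ∣ G ∣ ℕ.≟ suc ∣ F ∣ ⌋

IsArc : {n : ℕ} → Family n → Subset n → Subset n → Set
IsArc Δ G F = isArc Δ G F ≡ true

incident : {n : ℕ} → Subset n → Subset n → Subset n → Bool
incident F G E = (G =ˢ F) ∨ (E =ˢ F)

degree : {n : ℕ} → Family n → Subset n → ℕ
degree Δ F = countPairs (λ G E → isArc Δ G E ∧ incident F G E)

ArcSet : ℕ → Set
ArcSet n = Subset n → Subset n → Bool

incCount : {n : ℕ} → Family n → ArcSet n → Subset n → ℕ
incCount Δ M F = countPairs (λ G E → isArc Δ G E ∧ M G E ∧ incident F G E)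

OnArcs : {n : ℕ} → Family n → ArcSet n → Set
OnArcs Δ M = ∀ G F → M G F ≡ true → IsArc Δ G F

IsMatching : {n : ℕ} → Family n → ArcSet n → Set
IsMatching Δ M = OnArcs Δ M × (∀ F → Δ F ≡ true → incCount Δ M F ≤ 1)

-- step in the Hasse diagram after reversing the arcs of M
Step : {n : ℕ} → Family n → ArcSet n → Subset n → Subset n → Set
Step Δ M u v = (IsArc Δ u v × M u v ≡ false) Data.Sum.⊎ (IsArc Δ v u × M v u ≡ true)
  where import Data.Sum

Acyclic : {n : ℕ} → Family n → ArcSet n → Set
Acyclic Δ M = ∀ u → ¬ TransClosure (Step Δ M) u u

IsMorseMatching : {n : ℕ} → Family n → ArcSet n → Set
IsMorseMatching Δ M = IsMatching Δ M × Acyclic Δ M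

χ : {n : ℕ} → Family n → ArcSet n → Subset n → Subset n → ℚ
χ Δ M G F = if isArc Δ G F ∧ M G F then 1ℚ else 0ℚ

sumFin : (k : ℕ) → (Fin k → ℚ) → ℚ
sumFin zero    f = 0ℚ
sumFin (suc k) f = f zero ℚ.+ sumFin k (λ i → f (suc i))

AffIndep : {n : ℕ} → Family n → (k : ℕ) → (Fin (suc k) → ArcSet n) → Set
AffIndep Δ k p =
  (c : Fin k → ℚ) →
  (∀ G F → IsArc Δ G F →
     sumFin k (λ i → c i ℚ.* (χ Δ (p (suc i)) G F ℚ.- χ Δ (p zero) G F)) ≡ 0ℚ) →
  ∀ i → c i ≡ 0ℚ

-- the (finite) set of incidence vectors of arc sets satisfying P has
-- affine dimension k (= dimension of its convex hull)
HasAffDim : {n : ℕ} → Family n → (ArcSet n → Set) → ℕ → Set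
HasAffDim {n} Δ P k =
  (∃ λ (p : Fin (suc k) → ArcSet n) → (∀ i → P (p i)) × AffIndep Δ k p)
  × ((p : Fin (suc (suc k)) → ArcSet n) → (∀ i → P (p i)) → ¬ AffIndep Δ (suc k) p)

-- The inequality x(δ(F)) ≤ 1 defines a facet of P_M = conv{χ^M : M Morse}:
-- it is valid, and the face {x ∈ P_M : x(δ(F)) = 1} (the convex hull of the
-- vertices on it) has dimension dim P_M - 1.
DefinesFacet : {n : ℕ} → Family n → Subset n → Set
DefinesFacet Δ F =
  (∀ M → IsMorseMatching Δ M → incCount Δ M F ≤ 1)
  × ∃ λ k → HasAffDim Δ (IsMorseMatching Δ) (suc k)
          × HasAffDim Δ (λ M → IsMorseMatching Δ M × incCount Δ M F ≡ 1) k

module Submission where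

-- P_M is full-dimensional: the empty matching and the single arcs are Morse, and their
-- incidence vectors are affinely independent. On the face x(δ(F)) = 1 we find |A| affinely
-- independent Morse matchings. Fix two arcs a₀, a₁ ∈ δ(F). An arc r ∈ δ(F) gives {r}. An
-- arc r ∉ δ(F) shares no face with a₀ or with a₁ (otherwise the two shared faces, both of
-- size |F| ± 1, would be joined by r, contradicting parity), and r together with that arc
-- is a Morse matching: two disjoint arcs never have cross arcs in both directions, so a
-- weighted rank function decreases along the modified Hasse diagram. Listing first the
-- arcs outside δ(F) makes the incidence matrix of these matchings unitriangular. Neither
-- dimension can be larger, since more points would give a linear dependence among the |A|
-- coordinates, or on the face among the |A| - 1 coordinates other than x(a₀), which
-- x(δ(F)) = 1 determines.

open import Defs
open import Algebra.Bundles using (Ring)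
open import Data.Bool using (Bool; true; false; _∧_; if_then_else_)
import Data.Bool.Properties as Bool
open import Data.Empty using (⊥; ⊥-elim)
open import Data.Fin using (Fin; zero; suc; punchIn)
open import Data.Fin.Properties using (all?; ¬∀⟶∃¬; punchInᵢ≢i; suc-injective)
open import Data.Fin.Subset using (Subset; ∣_∣; _⊆_; _∩_; inside; outside) renaming (_∈_ to _∈ˢ_)
open import Data.Fin.Subset.Properties using (_⊆?_; drop-∷-⊆; p⊆q⇒∣p∣≤∣q∣; p∩q⊆p; p∩q⊆q; x∈p∩q⁺)
open import Data.List using (List; []; _∷_; _++_; map; filter; cartesianProduct; length; lookup)
open import Data.List.Membership.Propositional using (_∈_)
import Data.List.Membership.DecPropositional as DecMembership
open import Data.List.Membership.Propositional.Properties
  using (∈-map⁺; ∈-map⁻; ∈-++⁺ˡ; ∈-++⁺ʳ; ∈-cartesianProduct⁺; ∈-filter⁺; ∈-filter⁻; ∈-∃++; ∈-lookup)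
open import Data.List.Relation.Unary.Any using (here; there)
open import Data.List.Relation.Unary.Any.Properties using (lookup-index)
open import Data.List.Relation.Unary.All as All using ()
open import Data.List.Relation.Unary.AllPairs using ([]; _∷_)
open import Data.List.Relation.Unary.Unique.Propositional using (Unique)
import Data.List.Relation.Unary.Unique.Propositional.Properties as Unique
open import Data.List.Relation.Binary.Permutation.Propositional as ↭ using (_↭_)
open import Data.List.Relation.Binary.Permutation.Propositional.Properties using (shift; ∈-resp-↭)
import Data.List.Relation.Binary.Permutation.Setoid.Properties as PermutationSetoid
open import Data.Nat as ℕ using (ℕ; zero; suc; s≤s; s≤s⁻¹; z≤n; _≤_; _<_)
import Data.Nat.ListAction as ℕ
import Data.Nat.Properties as ℕ
open import Data.Nat.Properties using (<ᵇ⇒<)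
open import Data.Product using (∃; ∃₂; _×_; _,_; proj₁; proj₂; uncurry)
import Data.Product.Properties as Product
open import Data.Rational using (ℚ; 0ℚ; 1ℚ; _+_; _*_; -_; _-_; 1/_; ≢-nonZero)
import Data.Rational.Properties as ℚ
open import Data.Rational.Solver using (module +-*-Solver)
open import Data.Sum using (_⊎_; inj₁; inj₂)
open import Data.Vec using ([]; _∷_; here)
import Data.Vec.Properties as Vec
open import Data.Vec.Functional using (insertAt)
open import Data.Vec.Functional.Properties using (insertAt-lookup; insertAt-punchIn)
open import Function using (_∘_)
open import Relation.Binary.Construct.Closure.Transitive using (TransClosure; [_]; _∷_)
open import Relation.Binary.Definitions using (DecidableEquality)
open import Relation.Binary.PropositionalEquality hiding ([_])
open import Relation.Nullary using (¬_; Dec; yes; no; contradiction)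
open import Relation.Nullary.Decidable using (isYes; _⊎-dec_)
open import Relation.Unary using (Decidable)

open import Algebra.Properties.CommutativeSemigroup ℕ.+-commutativeSemigroup using (x∙yz≈y∙xz)
open import Algebra.Properties.Semiring.Sum (Ring.semiring ℚ.+-*-ring)
open import Algebra.Definitions.RawMonoid (Ring.+-rawMonoid ℚ.+-*-ring) using () renaming (_×_ to _×ℚ_)
open import Algebra.Properties.Monoid.Mult (Ring.+-monoid ℚ.+-*-ring) using (×-homo-+)
open +-*-Solver using (solve; _:+_; _:*_; _:-_; :-_; _:=_; con)

private variable
  A B : Set
  n : ℕ

bit : Bool → ℕ
bit b = if b then 1 else 0

indicator : Bool → ℚ
indicator b = if b then 1ℚ else 0ℚ

indicator-∧∧ : ∀ a b c → indicator (a ∧ b ∧ c) ≡ indicator c * indicator (a ∧ b)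
indicator-∧∧ true  true  true  = refl
indicator-∧∧ true  true  false = refl
indicator-∧∧ true  false true  = refl
indicator-∧∧ true  false false = refl
indicator-∧∧ false _     true  = refl
indicator-∧∧ false _     false = refl

∧-true⁻ : ∀ a {b} → a ∧ b ≡ true → a ≡ true × b ≡ true
∧-true⁻ true {true} _ = refl , refl

isYes-true⁻ : ∀ {P : Set} (d : Dec P) → isYes d ≡ true → P
isYes-true⁻ (yes p) _  = p
isYes-true⁻ (no _)  ()

isYes-false⁻ : ∀ {P : Set} (d : Dec P) → isYes d ≡ false → ¬ P
isYes-false⁻ (yes _) ()
isYes-false⁻ (no ¬p) _ = ¬p

isYes-true⁺ : ∀ {P : Set} (d : Dec P) → P → isYes d ≡ true
isYes-true⁺ (yes _) _  = refl
isYes-true⁺ (no ¬p) p = contradiction p ¬p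

isYes-false⁺ : ∀ {P : Set} (d : Dec P) → ¬ P → isYes d ≡ false
isYes-false⁺ (yes p) ¬p = contradiction p ¬p
isYes-false⁺ (no _)  _  = refl

count-++ : ∀ (q : A → Bool) xs ys → count q (xs ++ ys) ≡ count q xs ℕ.+ count q ys
count-++ q []       ys = refl
count-++ q (x ∷ xs) ys = trans (cong (bit (q x) ℕ.+_) (count-++ q xs ys)) (sym (ℕ.+-assoc (bit (q x)) _ _))

count-map : ∀ (q : B → Bool) (f : A → B) xs → count q (map f xs) ≡ count (q ∘ f) xs
count-map q f []       = refl
count-map q f (x ∷ xs) = cong (bit (q (f x)) ℕ.+_) (count-map q f xs)

count-cartesianProduct : ∀ (q : A × B → Bool) xs ys →
  count q (cartesianProduct xs ys) ≡ ℕ.sum (map (λ x → count (λ y → q (x , y)) ys) xs)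
count-cartesianProduct q []       ys = refl
count-cartesianProduct q (x ∷ xs) ys =
  trans (count-++ q (map (x ,_) ys) _) (cong₂ ℕ._+_ (count-map q (x ,_) ys) (count-cartesianProduct q xs ys))

count-filter : ∀ (q : A → Bool) {P : A → Set} (P? : Decidable P) xs →
               (∀ {x} → q x ≡ true → P x) → count q (filter P? xs) ≡ count q xs
count-filter q P? []       q⇒P = refl
count-filter q P? (x ∷ xs) q⇒P with P? x
... | yes _ = cong (bit (q x) ℕ.+_) (count-filter q P? xs q⇒P)
... | no ¬P with q x in qx
...   | true  = contradiction (q⇒P qx) ¬P
...   | false = count-filter q P? xs q⇒P

count-↭ : ∀ (q : A → Bool) {xs ys} → xs ↭ ys → count q xs ≡ count q ys
count-↭ q ↭.refl         = refl
count-↭ q (↭.prep x p)   = cong (bit (q x) ℕ.+_) (count-↭ q p)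
count-↭ q (↭.swap x y p) =
  trans (cong (λ c → bit (q x) ℕ.+ (bit (q y) ℕ.+ c)) (count-↭ q p)) (x∙yz≈y∙xz (bit (q x)) (bit (q y)) _)
count-↭ q (↭.trans p p′) = trans (count-↭ q p) (count-↭ q p′)

count-≥1 : ∀ (q : A → Bool) {x xs} → x ∈ xs → q x ≡ true → 1 ≤ count q xs
count-≥1 q              (here refl) qx rewrite qx = s≤s z≤n
count-≥1 q {xs = y ∷ _} (there x∈)  qx = ℕ.≤-trans (count-≥1 q x∈ qx) (ℕ.m≤n+m _ (bit (q y)))

count-≥1⁻ : ∀ (q : A → Bool) xs → 1 ≤ count q xs → ∃ λ x → x ∈ xs × q x ≡ true
count-≥1⁻ q (x ∷ xs) 1≤ with q x in qx
... | true  = x , here refl , qx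
... | false with y , y∈ , qy ← count-≥1⁻ q xs 1≤ = y , there y∈ , qy

count-≥2⁻ : ∀ (q : A → Bool) {xs} → Unique xs → 2 ≤ count q xs →
            ∃₂ λ x y → x ≢ y × q x ≡ true × q y ≡ true
count-≥2⁻ q {x ∷ xs} (x∉xs ∷ unique) 2≤ with q x in qx
... | true with y , y∈ , qy ← count-≥1⁻ q xs (s≤s⁻¹ 2≤) = x , y , All.lookup x∉xs y∈ , qx , qy
... | false = count-≥2⁻ q unique 2≤

count-≤1 : ∀ (q : A → Bool) {xs} → Unique xs → (∀ {x y} → q x ≡ true → q y ≡ true → x ≡ y) →
           count q xs ≤ 1
count-≤1 q {xs} unique q-unique with 2 ℕ.≤? count q xs
... | no 2≰ = s≤s⁻¹ (ℕ.≰⇒> 2≰)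
... | yes 2≤ with x , y , x≢y , qx , qy ← count-≥2⁻ q unique 2≤ = contradiction (q-unique qx qy) x≢y

count-≡1 : ∀ (q : A → Bool) {x xs} → Unique xs → x ∈ xs → q x ≡ true → (∀ {y} → q y ≡ true → y ≡ x) →
           count q xs ≡ 1
count-≡1 q unique x∈ qx only-x =
  ℕ.≤-antisym (count-≤1 q unique (λ qy qz → trans (only-x qy) (sym (only-x qz)))) (count-≥1 q x∈ qx)

count-∑ : ∀ (q : A → Bool) xs → ∑[ t < length xs ] indicator (q (lookup xs t)) ≡ count q xs ×ℚ 1ℚ
count-∑ q []       = refl
count-∑ q (x ∷ xs) = begin
  indicator (q x) + ∑[ t < length xs ] indicator (q (lookup xs t))  ≡⟨ cong₂ _+_ (indicator-× (q x)) (count-∑ q xs) ⟩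
  bit (q x) ×ℚ 1ℚ + count q xs ×ℚ 1ℚ                               ≡⟨ sym (×-homo-+ 1ℚ (bit (q x)) (count q xs)) ⟩
  count q (x ∷ xs) ×ℚ 1ℚ                                            ∎
  where
  open ≡-Reasoning
  indicator-× : ∀ b → indicator b ≡ bit b ×ℚ 1ℚ
  indicator-× true  = refl
  indicator-× false = refl

extract : ∀ {x} {xs : List A} → x ∈ xs → ∃ λ ys → x ∷ ys ↭ xs
extract x∈ with ys , zs , refl ← ∈-∃++ x∈ = ys ++ zs , ↭.↭-sym (shift _ ys zs)

lookup-injective : ∀ {xs : List A} → Unique xs → ∀ {i j} → lookup xs i ≡ lookup xs j → i ≡ j
lookup-injective {xs = x ∷ xs} (x∉xs ∷ unique) {zero}  {zero}  _  = refl
lookup-injective {xs = x ∷ xs} (x∉xs ∷ unique) {zero}  {suc j} eq = contradiction eq (All.lookup x∉xs (∈-lookup j))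
lookup-injective {xs = x ∷ xs} (x∉xs ∷ unique) {suc i} {zero}  eq = contradiction (sym eq) (All.lookup x∉xs (∈-lookup i))
lookup-injective {xs = x ∷ xs} (x∉xs ∷ unique) {suc i} {suc j} eq = cong suc (lookup-injective unique eq)

-- Linear dependence over ℚ

sumFin≡sum : ∀ k (f : Fin k → ℚ) → sumFin k f ≡ sum f
sumFin≡sum zero    f = refl
sumFin≡sum (suc k) f = cong (f zero +_) (sumFin≡sum k (f ∘ suc))

sum-zeros : ∀ {k} {f : Fin k → ℚ} → (∀ i → f i ≡ 0ℚ) → sum f ≡ 0ℚ
sum-zeros {k} f≡0 = trans (sum-cong-≗ f≡0) (sum-replicate-zero k)

sum-single : ∀ {k} {f : Fin k → ℚ} j → (∀ i → i ≢ j → f i ≡ 0ℚ) → sum f ≡ f j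
sum-single {suc k} {f} j others≡0 = begin
  sum f                      ≡⟨ sum-remove {i = j} f ⟩
  f j + sum (f ∘ punchIn j)  ≡⟨ cong (f j +_) (sum-zeros (λ i → others≡0 _ (punchInᵢ≢i j i))) ⟩
  f j + 0ℚ                   ≡⟨ ℚ.+-identityʳ (f j) ⟩
  f j                        ∎
  where open ≡-Reasoning

module _ {X : Set} where

  combination : ∀ {k} → (Fin k → ℚ) → (Fin k → X → ℚ) → X → ℚ
  combination {k} c v x = ∑[ i < k ] (c i * v i x)

  -- One step of Gaussian elimination: clear the coordinate x of all vectors but v j.
  module Pivot {k} (v : Fin (suc k) → X → ℚ) (x : X) (j : Fin (suc k)) (vⱼ≢0 : v j x ≢ 0ℚ) where

    instance _ = ≢-nonZero vⱼ≢0

    β : Fin k → ℚ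
    β i = v (punchIn j i) x * 1/ v j x

    reduced : Fin k → X → ℚ
    reduced i y = v (punchIn j i) y - β i * v j y

    reduced-pivot : ∀ i → reduced i x ≡ 0ℚ
    reduced-pivot i = begin
      u - u * 1/ v j x * v j x  ≡⟨ cong (_-_ u) (trans (ℚ.*-assoc u _ _) (cong (u *_) (ℚ.*-inverseˡ (v j x)))) ⟩
      u - u * 1ℚ                ≡⟨ cong (_-_ u) (ℚ.*-identityʳ u) ⟩
      u - u                     ≡⟨ ℚ.+-inverseʳ u ⟩
      0ℚ                        ∎
      where
      open ≡-Reasoning
      u = v (punchIn j i) x

    lift : (Fin k → ℚ) → Fin (suc k) → ℚ
    lift c = insertAt c j (∑[ i < k ] (- (c i * β i)))

    combination-lift : ∀ c y → combination (lift c) v y ≡ combination c reduced y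
    combination-lift c y = begin
      combination (lift c) v y
        ≡⟨ sum-remove {i = j} (λ i → lift c i * v i y) ⟩
      lift c j * v j y + ∑[ i < k ] (lift c (punchIn j i) * v (punchIn j i) y)
        ≡⟨ cong₂ (λ s t → s * v j y + t) (insertAt-lookup c j _)
                 (sum-cong-≗ (λ i → cong (_* v (punchIn j i) y) (insertAt-punchIn c j _ i))) ⟩
      ∑[ i < k ] (- (c i * β i)) * v j y + ∑[ i < k ] (c i * v (punchIn j i) y)
        ≡⟨ cong (_+ ∑[ i < k ] (c i * v (punchIn j i) y)) (*-distribʳ-sum (v j y) (λ i → - (c i * β i))) ⟩
      ∑[ i < k ] (- (c i * β i) * v j y) + ∑[ i < k ] (c i * v (punchIn j i) y)
        ≡⟨ sym (∑-distrib-+ (λ i → - (c i * β i) * v j y) (λ i → c i * v (punchIn j i) y)) ⟩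
      ∑[ i < k ] (- (c i * β i) * v j y + c i * v (punchIn j i) y)
        ≡⟨ sum-cong-≗ (λ i → expand (c i) (β i) (v j y) (v (punchIn j i) y)) ⟩
      combination c reduced y
        ∎
      where
      open ≡-Reasoning
      expand : ∀ c b u u′ → - (c * b) * u + c * u′ ≡ c * (u′ - b * u)
      expand = solve 4 (λ c b u u′ → (:- (c :* b)) :* u :+ c :* u′ := c :* (u′ :- b :* u)) refl

  dependent : ∀ {m k} (ys : Fin m → X) (v : Fin k → X → ℚ) → m < k →
              ∃ λ c → (∀ t → combination c v (ys t) ≡ 0ℚ) × ∃ λ j → c j ≢ 0ℚ
  dependent {zero}  {suc k} ys v _ = (λ _ → 1ℚ) , (λ ()) , zero , λ ()
  dependent {suc m} {suc k} ys v (s≤s m<k) with all? (λ j → v j (ys zero) ℚ.≟ 0ℚ)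
  ... | yes v≡0
    with c , vanishes , nonzero ← dependent (ys ∘ suc) v (ℕ.m<n⇒m<1+n m<k)
    = c , vanishes′ , nonzero
    where
    vanishes′ : ∀ t → combination c v (ys t) ≡ 0ℚ
    vanishes′ zero    = sum-zeros (λ i → trans (cong (c i *_) (v≡0 i)) (ℚ.*-zeroʳ (c i)))
    vanishes′ (suc t) = vanishes t
  ... | no ¬v≡0
    with j , vⱼ≢0 ← ¬∀⟶∃¬ _ _ (λ j → v j (ys zero) ℚ.≟ 0ℚ) ¬v≡0
    with c , vanishes , j′ , cⱼ′≢0 ← dependent (ys ∘ suc) (Pivot.reduced v (ys zero) j vⱼ≢0) m<k
    = lift c , vanishes′ , punchIn j j′ , cⱼ′≢0 ∘ trans (sym (insertAt-punchIn c j _ j′))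
    where
    open Pivot v (ys zero) j vⱼ≢0
    vanishes′ : ∀ t → combination (lift c) v (ys t) ≡ 0ℚ
    vanishes′ zero    =
      trans (combination-lift c _) (sum-zeros (λ i → trans (cong (c i *_) (reduced-pivot i)) (ℚ.*-zeroʳ (c i))))
    vanishes′ (suc t) = trans (combination-lift c _) (vanishes t)

  linearForm : ∀ {m} → X → (Fin m → X) → (Fin m → ℚ) → (X → ℚ) → ℚ
  linearForm {m} x₀ ys g w = w x₀ + ∑[ t < m ] (g t * w (ys t))

  module _ {m} (x₀ : X) (ys : Fin m → X) (g : Fin m → ℚ) where

    linearForm-combination : ∀ {k} (c : Fin k → ℚ) (v : Fin k → X → ℚ) →
      linearForm x₀ ys g (combination c v) ≡ ∑[ i < k ] (c i * linearForm x₀ ys g (v i))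
    linearForm-combination {k} c v = begin
      ∑[ i < k ] (c i * v i x₀) + ∑[ t < m ] (g t * ∑[ i < k ] (c i * v i (ys t)))
        ≡⟨ cong (∑[ i < k ] (c i * v i x₀) +_) (sum-cong-≗ (λ t → *-distribˡ-sum (g t) (λ i → c i * v i (ys t)))) ⟩
      ∑[ i < k ] (c i * v i x₀) + ∑[ t < m ] ∑[ i < k ] (g t * (c i * v i (ys t)))
        ≡⟨ cong (∑[ i < k ] (c i * v i x₀) +_) (∑-comm (λ t i → g t * (c i * v i (ys t)))) ⟩
      ∑[ i < k ] (c i * v i x₀) + ∑[ i < k ] ∑[ t < m ] (g t * (c i * v i (ys t)))
        ≡⟨ sym (∑-distrib-+ (λ i → c i * v i x₀) (λ i → ∑[ t < m ] (g t * (c i * v i (ys t))))) ⟩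
      ∑[ i < k ] (c i * v i x₀ + ∑[ t < m ] (g t * (c i * v i (ys t))))
        ≡⟨ sum-cong-≗ (λ i → cong (c i * v i x₀ +_) (sum-cong-≗ (λ t → swap (g t) (c i) (v i (ys t))))) ⟩
      ∑[ i < k ] (c i * v i x₀ + ∑[ t < m ] (c i * (g t * v i (ys t))))
        ≡⟨ sum-cong-≗ (λ i → cong (c i * v i x₀ +_) (sym (*-distribˡ-sum (c i) (λ t → g t * v i (ys t))))) ⟩
      ∑[ i < k ] (c i * v i x₀ + c i * ∑[ t < m ] (g t * v i (ys t)))
        ≡⟨ sum-cong-≗ (λ i → sym (ℚ.*-distribˡ-+ (c i) (v i x₀) _)) ⟩
      ∑[ i < k ] (c i * linearForm x₀ ys g (v i))
        ∎
      where
      open ≡-Reasoning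
      swap : ∀ a b c → a * (b * c) ≡ b * (a * c)
      swap = solve 3 (λ a b c → a :* (b :* c) := b :* (a :* c)) refl

    linearForm-sub : ∀ (u w : X → ℚ) →
      linearForm x₀ ys g (λ y → u y - w y) ≡ linearForm x₀ ys g u - linearForm x₀ ys g w
    linearForm-sub u w = begin
      u x₀ - w x₀ + ∑[ t < m ] (g t * (u (ys t) - w (ys t)))
        ≡⟨ cong (u x₀ - w x₀ +_) (sum-cong-≗ (λ t → split (g t) (u (ys t)) (w (ys t)))) ⟩
      u x₀ - w x₀ + ∑[ t < m ] (g t * u (ys t) + - 1ℚ * (g t * w (ys t)))
        ≡⟨ cong (u x₀ - w x₀ +_) (∑-distrib-+ (λ t → g t * u (ys t)) (λ t → - 1ℚ * (g t * w (ys t)))) ⟩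
      u x₀ - w x₀ + (∑[ t < m ] (g t * u (ys t)) + ∑[ t < m ] (- 1ℚ * (g t * w (ys t))))
        ≡⟨ cong (λ s → u x₀ - w x₀ + (∑[ t < m ] (g t * u (ys t)) + s))
                (sym (*-distribˡ-sum (- 1ℚ) (λ t → g t * w (ys t)))) ⟩
      u x₀ - w x₀ + (∑[ t < m ] (g t * u (ys t)) + - 1ℚ * ∑[ t < m ] (g t * w (ys t)))
        ≡⟨ regroup (u x₀) (w x₀) _ _ ⟩
      linearForm x₀ ys g u - linearForm x₀ ys g w
        ∎
      where
      open ≡-Reasoning
      split : ∀ a b c → a * (b - c) ≡ a * b + - 1ℚ * (a * c)
      split = solve 3 (λ a b c → a :* (b :- c) := a :* b :+ (:- con 1ℚ) :* (a :* c)) refl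
      regroup : ∀ a b s t → a - b + (s + - 1ℚ * t) ≡ (a + s) - (b + t)
      regroup = solve 4 (λ a b s t → a :- b :+ (s :+ (:- con 1ℚ) :* t) := (a :+ s) :- (b :+ t)) refl

_≟ₛ_ : DecidableEquality (Subset n)
_≟ₛ_ = Vec.≡-dec Bool._≟_

⊆-size-≡ : ∀ {p q : Subset n} → p ⊆ q → ∣ q ∣ ≤ ∣ p ∣ → p ≡ q
⊆-size-≡ {p = []}          {[]}          _   _   = refl
⊆-size-≡ {p = inside ∷ p}  {inside ∷ q}  p⊆q q≤p = cong (inside ∷_) (⊆-size-≡ (drop-∷-⊆ p⊆q) (s≤s⁻¹ q≤p))
⊆-size-≡ {p = outside ∷ p} {outside ∷ q} p⊆q q≤p = cong (outside ∷_) (⊆-size-≡ (drop-∷-⊆ p⊆q) q≤p)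
⊆-size-≡ {p = inside ∷ p}  {outside ∷ q} p⊆q _   with () ← p⊆q here
⊆-size-≡ {p = outside ∷ p} {inside ∷ q}  p⊆q q≤p =
  contradiction (ℕ.<-≤-trans (s≤s (p⊆q⇒∣p∣≤∣q∣ (drop-∷-⊆ p⊆q))) q≤p) (ℕ.<-irrefl refl)

SizesAdjacent : ℕ → ℕ → Set
SizesAdjacent x y = x ≡ suc y ⊎ y ≡ suc x

sizesAdjacent-parity : ∀ {f x y} → SizesAdjacent f x → SizesAdjacent f y → ¬ SizesAdjacent x y
sizesAdjacent-parity (inj₁ refl) (inj₁ refl) (inj₁ ())
sizesAdjacent-parity (inj₁ refl) (inj₁ refl) (inj₂ ())
sizesAdjacent-parity (inj₁ refl) (inj₂ refl) (inj₁ ())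
sizesAdjacent-parity (inj₁ refl) (inj₂ refl) (inj₂ ())
sizesAdjacent-parity (inj₂ refl) (inj₁ refl) (inj₁ ())
sizesAdjacent-parity (inj₂ refl) (inj₁ refl) (inj₂ ())
sizesAdjacent-parity (inj₂ refl) (inj₂ refl) (inj₁ ())
sizesAdjacent-parity (inj₂ refl) (inj₂ refl) (inj₂ ())

Arc : ℕ → Set
Arc n = Subset n × Subset n

_≟ₐ_ : DecidableEquality (Arc n)
_≟ₐ_ = Product.≡-dec _≟ₛ_ _≟ₛ_

_∈?_ : (a : Arc n) (L : List (Arc n)) → Dec (a ∈ L)
a ∈? L = DecMembership._∈?_ _≟ₐ_ a L

∈-allSubsets : (F : Subset n) → F ∈ allSubsets n
∈-allSubsets []                  = here refl
∈-allSubsets {suc n} (true ∷ F)  = ∈-++⁺ˡ (∈-map⁺ (true ∷_) (∈-allSubsets F))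
∈-allSubsets {suc n} (false ∷ F) = ∈-++⁺ʳ (map (true ∷_) (allSubsets n)) (∈-map⁺ (false ∷_) (∈-allSubsets F))

allSubsets-unique : ∀ n → Unique (allSubsets n)
allSubsets-unique zero    = All.[] ∷ []
allSubsets-unique (suc n) =
  Unique.++⁺ (Unique.map⁺ Vec.∷-injectiveʳ (allSubsets-unique n)) (Unique.map⁺ Vec.∷-injectiveʳ (allSubsets-unique n))
             heads-differ
  where
  heads-differ : ∀ {F} → ¬ (F ∈ map (true ∷_) (allSubsets n) × F ∈ map (false ∷_) (allSubsets n))
  heads-differ (F∈ , F∈′) with ∈-map⁻ (true ∷_) F∈ | ∈-map⁻ (false ∷_) F∈′
  ... | _ , _ , refl | _ , _ , ()

allPairs : ∀ n → List (Arc n)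
allPairs n = cartesianProduct (allSubsets n) (allSubsets n)

∈-allPairs : (a : Arc n) → a ∈ allPairs n
∈-allPairs (G , E) = ∈-cartesianProduct⁺ (∈-allSubsets G) (∈-allSubsets E)

allPairs-unique : ∀ n → Unique (allPairs n)
allPairs-unique n = Unique.cartesianProduct⁺ (allSubsets-unique n) (allSubsets-unique n)

sum-by-equations : {f : List ℕ → ℕ} → f [] ≡ 0 → (∀ k ks → f (k ∷ ks) ≡ k ℕ.+ f ks) →
                   ∀ ks → f ks ≡ ℕ.sum ks
sum-by-equations f[] f∷ []       = f[]
sum-by-equations f[] f∷ (k ∷ ks) = trans (f∷ k ks) (cong (k ℕ.+_) (sum-by-equations f[] f∷ ks))

-- countPairs adds up its rows with a local function; abstracting the list of rows lets
-- unification name that function.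
countPairs-sum : (p : Subset n → Subset n → Bool) →
                 countPairs p ≡ ℕ.sum (map (λ G → count (p G) (allSubsets n)) (allSubsets n))
countPairs-sum {n} p with map (λ G → count (p G) (allSubsets n)) (allSubsets n) | sum-by-equations {f = _}
... | rows | by-equations = by-equations refl (λ _ _ → refl) rows

countPairs≡count : (p : Subset n → Subset n → Bool) → countPairs p ≡ count (uncurry p) (allPairs n)
countPairs≡count {n} p =
  trans (countPairs-sum p) (sym (count-cartesianProduct (uncurry p) (allSubsets n) (allSubsets n)))

module _ (p : Subset n → Subset n → Bool) where

  countPairs-≥2⁻ : 2 ≤ countPairs p → ∃₂ λ x y → x ≢ y × uncurry p x ≡ true × uncurry p y ≡ true
  countPairs-≥2⁻ 2≤ = count-≥2⁻ (uncurry p) (allPairs-unique n) (subst (2 ≤_) (countPairs≡count p) 2≤)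

  countPairs-≤1 : (∀ {x y} → uncurry p x ≡ true → uncurry p y ≡ true → x ≡ y) → countPairs p ≤ 1
  countPairs-≤1 p-unique =
    subst (_≤ 1) (sym (countPairs≡count p)) (count-≤1 (uncurry p) (allPairs-unique n) p-unique)

  countPairs-≡1 : ∀ {x} → uncurry p x ≡ true → (∀ {y} → uncurry p y ≡ true → y ≡ x) → countPairs p ≡ 1
  countPairs-≡1 {x} px only-x =
    trans (countPairs≡count p) (count-≡1 (uncurry p) (allPairs-unique n) (∈-allPairs x) px only-x)

_∈ₐ_ : Subset n → Arc n → Set
X ∈ₐ (G , E) = G ≡ X ⊎ E ≡ X

_∈ₐ?_ : (X : Subset n) (a : Arc n) → Dec (X ∈ₐ a)
X ∈ₐ? (G , E) = (G ≟ₛ X) ⊎-dec (E ≟ₛ X)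

incident⇒∈ₐ : ∀ {X G E : Subset n} → incident X G E ≡ true → X ∈ₐ (G , E)
incident⇒∈ₐ {X = X} {G} {E} inc with G ≟ₛ X
... | yes G≡X = inj₁ G≡X
... | no _    = inj₂ (isYes-true⁻ (E ≟ₛ X) inc)

∈ₐ⇒incident : ∀ {X G E : Subset n} → X ∈ₐ (G , E) → incident X G E ≡ true
∈ₐ⇒incident {X = X} {G} {E} (inj₁ G≡X) rewrite isYes-true⁺ (G ≟ₛ X) G≡X = refl
∈ₐ⇒incident {X = X} {G} {E} (inj₂ E≡X) rewrite isYes-true⁺ (E ≟ₛ X) E≡X = Bool.∨-zeroʳ _

Disjoint : Arc n → Arc n → Set
Disjoint a b = ∀ {X} → X ∈ₐ a → X ∈ₐ b → ⊥

Disjoint-sym : ∀ {a b : Arc n} → Disjoint a b → Disjoint b a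
Disjoint-sym disjoint X∈b X∈a = disjoint X∈a X∈b

disjoint? : (a b : Arc n) → Disjoint a b ⊎ ∃ λ X → X ∈ₐ a × X ∈ₐ b
disjoint? (Ga , Ea) b with Ga ∈ₐ? b | Ea ∈ₐ? b
... | yes Ga∈b | _        = inj₂ (Ga , inj₁ refl , Ga∈b)
... | no _     | yes Ea∈b = inj₂ (Ea , inj₂ refl , Ea∈b)
... | no Ga∉b  | no Ea∉b  = inj₁ λ where
  (inj₁ refl) X∈b → Ga∉b X∈b
  (inj₂ refl) X∈b → Ea∉b X∈b

Joins : Arc n → Subset n → Subset n → Set
Joins a X Y = a ≡ (X , Y) ⊎ a ≡ (Y , X)

joins : ∀ {X Y} (a : Arc n) → X ∈ₐ a → Y ∈ₐ a → X ≢ Y → Joins a X Y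
joins _ (inj₁ refl) (inj₁ refl) X≢Y = contradiction refl X≢Y
joins _ (inj₁ refl) (inj₂ refl) _   = inj₁ refl
joins _ (inj₂ refl) (inj₁ refl) _   = inj₂ refl
joins _ (inj₂ refl) (inj₂ refl) X≢Y = contradiction refl X≢Y

⟦_⟧ : List (Arc n) → ArcSet n
⟦ L ⟧ G E = isYes ((G , E) ∈? L)

⟦⟧-true⁻ : ∀ {L : List (Arc n)} a → uncurry ⟦ L ⟧ a ≡ true → a ∈ L
⟦⟧-true⁻ {L = L} a = isYes-true⁻ (a ∈? L)

⟦⟧-false⁻ : ∀ {L : List (Arc n)} a → uncurry ⟦ L ⟧ a ≡ false → ¬ a ∈ L
⟦⟧-false⁻ {L = L} a = isYes-false⁻ (a ∈? L)

⟦⟧-true⁺ : ∀ {L : List (Arc n)} {a} → a ∈ L → uncurry ⟦ L ⟧ a ≡ true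
⟦⟧-true⁺ {L = L} {a} = isYes-true⁺ (a ∈? L)

⟦⟧-false⁺ : ∀ {L : List (Arc n)} {a} → ¬ a ∈ L → uncurry ⟦ L ⟧ a ≡ false
⟦⟧-false⁺ {L = L} {a} = isYes-false⁺ (a ∈? L)

module Hasse (Δ : Family n) where

  IsArcₐ : Arc n → Set
  IsArcₐ = uncurry (IsArc Δ)

  isArc? : Decidable IsArcₐ
  isArc? a = uncurry (isArc Δ) a Bool.≟ true

  arc⁻ : ∀ {G E} → IsArc Δ G E → E ⊆ G × ∣ G ∣ ≡ suc ∣ E ∣
  arc⁻ {G} {E} arc
    with _ , E-arc ← ∧-true⁻ (Δ G) arc
    with _ , shape ← ∧-true⁻ (Δ E) E-arc
    with E⊆G , size ← ∧-true⁻ (isYes (E ⊆? G)) shape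
    = isYes-true⁻ (E ⊆? G) E⊆G , isYes-true⁻ (∣ G ∣ ℕ.≟ suc ∣ E ∣) size

  arc-⊆ : ∀ {G E} → IsArc Δ G E → E ⊆ G
  arc-⊆ = proj₁ ∘ arc⁻

  arc-size : ∀ {G E} → IsArc Δ G E → ∣ G ∣ ≡ suc ∣ E ∣
  arc-size = proj₂ ∘ arc⁻

  arc-≢ : ∀ {G E} → IsArc Δ G E → G ≢ E
  arc-≢ arc refl = ℕ.1+n≢n (sym (arc-size arc))

  arcs : List (Arc n)
  arcs = filter isArc? (allPairs n)

  ∈-arcs⁺ : ∀ {a} → IsArcₐ a → a ∈ arcs
  ∈-arcs⁺ {a} arc = ∈-filter⁺ isArc? (∈-allPairs a) arc

  ∈-arcs⁻ : ∀ {a} → a ∈ arcs → IsArcₐ a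
  ∈-arcs⁻ a∈ = proj₂ (∈-filter⁻ isArc? {xs = allPairs n} a∈)

  arcs-unique : Unique arcs
  arcs-unique = Unique.filter⁺ isArc? (allPairs-unique n)

  countPairs≡count-arcs : (p : Subset n → Subset n → Bool) → (∀ {G E} → p G E ≡ true → IsArc Δ G E) →
                          countPairs p ≡ count (uncurry p) arcs
  countPairs≡count-arcs p p⇒arc =
    trans (countPairs≡count p) (sym (count-filter (uncurry p) isArc? (allPairs n) p⇒arc))

  joins-sizes : ∀ {a X Y} → IsArcₐ a → Joins a X Y → SizesAdjacent ∣ X ∣ ∣ Y ∣
  joins-sizes arc (inj₁ refl) = inj₁ (arc-size arc)
  joins-sizes arc (inj₂ refl) = inj₂ (arc-size arc)

  joins-unique : ∀ {a b X Y} → IsArcₐ a → IsArcₐ b → Joins a X Y → Joins b X Y → a ≡ b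
  joins-unique _    _    (inj₁ refl) (inj₁ refl) = refl
  joins-unique _    _    (inj₂ refl) (inj₂ refl) = refl
  joins-unique arcᵃ arcᵇ (inj₁ refl) (inj₂ refl) =
    ⊥-elim (ℕ.<-asym (ℕ.≤-reflexive (sym (arc-size arcᵃ))) (ℕ.≤-reflexive (sym (arc-size arcᵇ))))
  joins-unique arcᵃ arcᵇ (inj₂ refl) (inj₁ refl) =
    ⊥-elim (ℕ.<-asym (ℕ.≤-reflexive (sym (arc-size arcᵃ))) (ℕ.≤-reflexive (sym (arc-size arcᵇ))))

  two-incident-arcs : ∀ {F} → 2 ≤ degree Δ F →
                      ∃₂ λ a₀ a₁ → a₀ ≢ a₁ × (IsArcₐ a₀ × F ∈ₐ a₀) × (IsArcₐ a₁ × F ∈ₐ a₁)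
  two-incident-arcs {F} 2≤deg
    with a₀ , a₁ , a₀≢a₁ , p₀ , p₁ ← countPairs-≥2⁻ (λ G E → isArc Δ G E ∧ incident F G E) 2≤deg =
    a₀ , a₁ , a₀≢a₁ , unpack a₀ p₀ , unpack a₁ p₁
    where
    unpack : ∀ a → uncurry (λ G E → isArc Δ G E ∧ incident F G E) a ≡ true → IsArcₐ a × F ∈ₐ a
    unpack (G , E) p with arc , inc ← ∧-true⁻ (isArc Δ G E) p = arc , incident⇒∈ₐ inc

  -- If a₀ and a₁ both met r, they would meet it in distinct faces (as a₀ ≢ a₁), which r
  -- joins although both differ in size from F by one.
  some-disjoint : ∀ {F a₀ a₁ r} → a₀ ≢ a₁ → IsArcₐ a₀ → IsArcₐ a₁ → IsArcₐ r →
                  F ∈ₐ a₀ → F ∈ₐ a₁ → ¬ F ∈ₐ r → Disjoint a₀ r ⊎ Disjoint a₁ r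
  some-disjoint {F} {a₀} {a₁} {r} a₀≢a₁ arc₀ arc₁ arcʳ F∈a₀ F∈a₁ F∉r
    with disjoint? a₀ r | disjoint? a₁ r
  ... | inj₁ a₀-disjoint | _                = inj₁ a₀-disjoint
  ... | inj₂ _           | inj₁ a₁-disjoint = inj₂ a₁-disjoint
  ... | inj₂ (X₀ , X₀∈a₀ , X₀∈r) | inj₂ (X₁ , X₁∈a₁ , X₁∈r) = ⊥-elim (by-cases (X₀ ≟ₛ X₁))
    where
    a₀-joins = joins a₀ F∈a₀ X₀∈a₀ (λ { refl → F∉r X₀∈r })
    a₁-joins = joins a₁ F∈a₁ X₁∈a₁ (λ { refl → F∉r X₁∈r })
    by-cases : Dec (X₀ ≡ X₁) → ⊥
    by-cases (yes refl) = a₀≢a₁ (joins-unique arc₀ arc₁ a₀-joins a₁-joins)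
    by-cases (no X₀≢X₁) = sizesAdjacent-parity (joins-sizes arc₀ a₀-joins) (joins-sizes arc₁ a₁-joins)
                                               (joins-sizes arcʳ (joins r X₀∈r X₁∈r X₀≢X₁))

  -- Both lower faces would be the intersection of the two upper faces.
  no-crossing : ∀ {Ga Ea Gb Eb} → IsArc Δ Ga Ea → IsArc Δ Gb Eb → Disjoint (Ga , Ea) (Gb , Eb) →
                IsArc Δ Gb Ea → ¬ IsArc Δ Ga Eb
  no-crossing {Ga} {Ea} {Gb} {Eb} a b disjoint Gb→Ea Ga→Eb with ∣ Ga ∩ Gb ∣ ℕ.≤? ∣ Ea ∣
  ... | yes small = disjoint (inj₂ refl) (inj₂ (trans Eb≡Ga∩Gb (sym Ea≡Ga∩Gb)))
    where
    Ea≡Ga∩Gb = ⊆-size-≡ (λ x∈ → x∈p∩q⁺ (arc-⊆ a x∈ , arc-⊆ Gb→Ea x∈)) small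
    ∣Ea∣≡∣Eb∣ = ℕ.suc-injective (trans (sym (arc-size a)) (arc-size Ga→Eb))
    Eb≡Ga∩Gb = ⊆-size-≡ (λ x∈ → x∈p∩q⁺ (arc-⊆ Ga→Eb x∈ , arc-⊆ b x∈))
                        (subst (∣ Ga ∩ Gb ∣ ≤_) ∣Ea∣≡∣Eb∣ small)
  ... | no large = disjoint (inj₁ refl) (inj₁ (sym Ga≡Gb))
    where
    Ga∩Gb≡Ga = ⊆-size-≡ (p∩q⊆p Ga Gb) (subst (_≤ ∣ Ga ∩ Gb ∣) (sym (arc-size a)) (ℕ.≰⇒> large))
    Ga≡Gb = ⊆-size-≡ (λ x∈ → p∩q⊆q Ga Gb (subst (_ ∈ˢ_) (sym Ga∩Gb≡Ga) x∈))
                     (ℕ.≤-reflexive (trans (arc-size Gb→Ea) (sym (arc-size a))))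

  -- Morse matchings with at most two arcs

  matchedAt : ArcSet n → Subset n → Arc n → Bool
  matchedAt M X = uncurry (λ G E → isArc Δ G E ∧ M G E ∧ incident X G E)

  matchedAt⁻ : ∀ {M X} a → matchedAt M X a ≡ true → IsArcₐ a × uncurry M a ≡ true × X ∈ₐ a
  matchedAt⁻ {M} (G , E) h with arc , rest ← ∧-true⁻ (isArc Δ G E) h with m , inc ← ∧-true⁻ (M G E) rest =
    arc , m , incident⇒∈ₐ inc

  matchedAt⁺ : ∀ {M X a} → IsArcₐ a → uncurry M a ≡ true → X ∈ₐ a → matchedAt M X a ≡ true
  matchedAt⁺ arc m X∈ = cong₂ _∧_ arc (cong₂ _∧_ m (∈ₐ⇒incident X∈))

  ⟦⟧-isMatching : ∀ L → (∀ {a} → a ∈ L → IsArcₐ a) →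
                  (∀ {X a b} → a ∈ L → b ∈ L → X ∈ₐ a → X ∈ₐ b → a ≡ b) → IsMatching Δ ⟦ L ⟧
  ⟦⟧-isMatching L L-arcs L-matching = (λ G E m → L-arcs (⟦⟧-true⁻ (G , E) m)) , λ X _ → countPairs-≤1 _ (one-at X)
    where
    one-at : ∀ X {a b} → matchedAt ⟦ L ⟧ X a ≡ true → matchedAt ⟦ L ⟧ X b ≡ true → a ≡ b
    one-at X {a} {b} pa pb
      with _ , ma , X∈a ← matchedAt⁻ {⟦ L ⟧} {X} a pa | _ , mb , X∈b ← matchedAt⁻ {⟦ L ⟧} {X} b pb =
      L-matching (⟦⟧-true⁻ a ma) (⟦⟧-true⁻ b mb) X∈a X∈b

  -- c ∣u∣ + w u is a potential strictly decreasing along the modified Hasse diagram.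
  acyclic-by-weight : (M : ArcSet n) (c : ℕ) (w : Subset n → ℕ) →
    (∀ {G E} → IsArc Δ G E → M G E ≡ false → w E < c ℕ.+ w G) →
    (∀ {G E} → IsArc Δ G E → M G E ≡ true → c ℕ.+ w G < w E) →
    Acyclic Δ M
  acyclic-by-weight M c w unmatched matched u cycle = ℕ.<-irrefl refl (descends cycle)
    where
    potential : Subset n → ℕ
    potential u = c ℕ.* ∣ u ∣ ℕ.+ w u
    peel : ∀ m x → c ℕ.* suc m ℕ.+ x ≡ c ℕ.* m ℕ.+ (c ℕ.+ x)
    peel m x = trans (cong (ℕ._+ x) (trans (ℕ.*-suc c m) (ℕ.+-comm c (c ℕ.* m)))) (ℕ.+-assoc (c ℕ.* m) c x)
    step : ∀ {u v} → Step Δ M u v → potential v < potential u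
    step {u} {v} (inj₁ (arc , m)) rewrite arc-size arc | peel ∣ v ∣ (w u) =
      ℕ.+-monoʳ-< (c ℕ.* ∣ v ∣) (unmatched arc m)
    step {u} {v} (inj₂ (arc , m)) rewrite arc-size arc | peel ∣ u ∣ (w v) =
      ℕ.+-monoʳ-< (c ℕ.* ∣ u ∣) (matched arc m)
    descends : ∀ {u v} → TransClosure (Step Δ M) u v → potential v < potential u
    descends [ s ]    = step s
    descends (s ∷ ss) = ℕ.<-trans (descends ss) (step s)

  ∅-isMorse : IsMorseMatching Δ ⟦ [] ⟧
  ∅-isMorse =
    ⟦⟧-isMatching [] (λ ()) (λ ()) , acyclic-by-weight ⟦ [] ⟧ 1 (λ _ → 0) (λ _ _ → s≤s z≤n) (λ _ ())

  module Singleton {Ga Ea : Subset n} (a : IsArc Δ Ga Ea) where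

    weight : Subset n → ℕ
    weight u = if isYes (u ≟ₛ Ga) then 0 else if isYes (u ≟ₛ Ea) then 4 else 2

    data Role (u : Subset n) : ℕ → Set where
      top    : u ≡ Ga → Role u 0
      bottom : u ≡ Ea → Role u 4
      other  : Role u 2

    role : ∀ u → Role u (weight u)
    role u with u ≟ₛ Ga | u ≟ₛ Ea
    ... | yes u≡Ga | _        = top u≡Ga
    ... | no _     | yes u≡Ea = bottom u≡Ea
    ... | no _     | no _     = other

    unmatched-descends : ∀ {G E} → IsArc Δ G E → ⟦ (Ga , Ea) ∷ [] ⟧ G E ≡ false → weight E < 3 ℕ.+ weight G
    unmatched-descends {G} {E} _ m with weight E | role E | weight G | role G
    ... | _ | top _       | _ | _        = <ᵇ⇒< _ _ _
    ... | _ | other       | _ | _        = <ᵇ⇒< _ _ _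
    ... | _ | bottom refl | _ | top refl = contradiction (here refl) (⟦⟧-false⁻ (G , E) m)
    ... | _ | bottom _    | _ | bottom _ = <ᵇ⇒< _ _ _
    ... | _ | bottom _    | _ | other    = <ᵇ⇒< _ _ _

    matched-ascends : ∀ {G E} → IsArc Δ G E → ⟦ (Ga , Ea) ∷ [] ⟧ G E ≡ true → 3 ℕ.+ weight G < weight E
    matched-ascends {G} {E} _ m with here refl ← ⟦⟧-true⁻ (G , E) m
      rewrite isYes-true⁺ (Ga ≟ₛ Ga) refl | isYes-false⁺ (Ea ≟ₛ Ga) (arc-≢ a ∘ sym)
            | isYes-true⁺ (Ea ≟ₛ Ea) refl
      = <ᵇ⇒< _ _ _

    isMorse : IsMorseMatching Δ ⟦ (Ga , Ea) ∷ [] ⟧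
    isMorse = ⟦⟧-isMatching _ (λ { (here refl) → a }) (λ { (here refl) (here refl) _ _ → refl }) ,
              acyclic-by-weight _ 3 weight unmatched-descends matched-ascends

  -- The weights make the cross arc from Ga down to Eb descend; the one from Gb down to Ea
  -- would not, and is excluded.
  module Pair {Ga Ea Gb Eb : Subset n} (a : IsArc Δ Ga Ea) (b : IsArc Δ Gb Eb)
              (disjoint : Disjoint (Ga , Ea) (Gb , Eb)) (no-cross : ¬ IsArc Δ Gb Ea) where

    weight : Subset n → ℕ
    weight u = if isYes (u ≟ₛ Gb) then 0 else if isYes (u ≟ₛ Ga) then 2
               else if isYes (u ≟ₛ Eb) then 6 else if isYes (u ≟ₛ Ea) then 8 else 4

    data Role (u : Subset n) : ℕ → Set where
      top-b    : u ≡ Gb → Role u 0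
      top-a    : u ≡ Ga → Role u 2
      bottom-b : u ≡ Eb → Role u 6
      bottom-a : u ≡ Ea → Role u 8
      other    : Role u 4

    role : ∀ u → Role u (weight u)
    role u with u ≟ₛ Gb | u ≟ₛ Ga | u ≟ₛ Eb | u ≟ₛ Ea
    ... | yes u≡Gb | _        | _        | _        = top-b u≡Gb
    ... | no _     | yes u≡Ga | _        | _        = top-a u≡Ga
    ... | no _     | no _     | yes u≡Eb | _        = bottom-b u≡Eb
    ... | no _     | no _     | no _     | yes u≡Ea = bottom-a u≡Ea
    ... | no _     | no _     | no _     | no _     = other

    M : ArcSet n
    M = ⟦ (Ga , Ea) ∷ (Gb , Eb) ∷ [] ⟧

    unmatched-descends : ∀ {G E} → IsArc Δ G E → M G E ≡ false → weight E < 5 ℕ.+ weight G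
    unmatched-descends {G} {E} arc m with weight E | role E | weight G | role G
    ... | _ | top-b _       | _ | _          = <ᵇ⇒< _ _ _
    ... | _ | top-a _       | _ | _          = <ᵇ⇒< _ _ _
    ... | _ | other         | _ | _          = <ᵇ⇒< _ _ _
    ... | _ | bottom-b refl | _ | top-b refl = contradiction (there (here refl)) (⟦⟧-false⁻ (G , E) m)
    ... | _ | bottom-b _    | _ | top-a _    = <ᵇ⇒< _ _ _
    ... | _ | bottom-b _    | _ | bottom-b _ = <ᵇ⇒< _ _ _
    ... | _ | bottom-b _    | _ | bottom-a _ = <ᵇ⇒< _ _ _
    ... | _ | bottom-b _    | _ | other      = <ᵇ⇒< _ _ _
    ... | _ | bottom-a refl | _ | top-b refl = contradiction arc no-cross
    ... | _ | bottom-a refl | _ | top-a refl = contradiction (here refl) (⟦⟧-false⁻ (G , E) m)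
    ... | _ | bottom-a _    | _ | bottom-b _ = <ᵇ⇒< _ _ _
    ... | _ | bottom-a _    | _ | bottom-a _ = <ᵇ⇒< _ _ _
    ... | _ | bottom-a _    | _ | other      = <ᵇ⇒< _ _ _

    Ga≢Gb : Ga ≢ Gb
    Ga≢Gb Ga≡Gb = disjoint (inj₁ refl) (inj₁ (sym Ga≡Gb))

    Ea≢Gb : Ea ≢ Gb
    Ea≢Gb Ea≡Gb = disjoint (inj₂ refl) (inj₁ (sym Ea≡Gb))

    Ea≢Eb : Ea ≢ Eb
    Ea≢Eb Ea≡Eb = disjoint (inj₂ refl) (inj₂ (sym Ea≡Eb))

    Eb≢Ga : Eb ≢ Ga
    Eb≢Ga Eb≡Ga = disjoint (inj₁ refl) (inj₂ Eb≡Ga)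

    matched-ascends : ∀ {G E} → IsArc Δ G E → M G E ≡ true → 5 ℕ.+ weight G < weight E
    matched-ascends {G} {E} _ m with ⟦⟧-true⁻ (G , E) m
    ... | here refl
      rewrite isYes-false⁺ (Ga ≟ₛ Gb) Ga≢Gb | isYes-true⁺ (Ga ≟ₛ Ga) refl
            | isYes-false⁺ (Ea ≟ₛ Gb) Ea≢Gb | isYes-false⁺ (Ea ≟ₛ Ga) (arc-≢ a ∘ sym)
            | isYes-false⁺ (Ea ≟ₛ Eb) Ea≢Eb | isYes-true⁺ (Ea ≟ₛ Ea) refl
      = <ᵇ⇒< _ _ _
    ... | there (here refl)
      rewrite isYes-true⁺ (Gb ≟ₛ Gb) refl | isYes-false⁺ (Eb ≟ₛ Gb) (arc-≢ b ∘ sym)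
            | isYes-false⁺ (Eb ≟ₛ Ga) Eb≢Ga | isYes-true⁺ (Eb ≟ₛ Eb) refl
      = <ᵇ⇒< _ _ _

    isMorse : IsMorseMatching Δ M
    isMorse = ⟦⟧-isMatching _ arcs-M matching-M , acyclic-by-weight M 5 weight unmatched-descends matched-ascends
      where
      arcs-M : ∀ {x} → x ∈ (Ga , Ea) ∷ (Gb , Eb) ∷ [] → IsArcₐ x
      arcs-M (here refl)         = a
      arcs-M (there (here refl)) = b
      matching-M : ∀ {X x y} → x ∈ (Ga , Ea) ∷ (Gb , Eb) ∷ [] → y ∈ (Ga , Ea) ∷ (Gb , Eb) ∷ [] →
                   X ∈ₐ x → X ∈ₐ y → x ≡ y
      matching-M (here refl)         (here refl)         _   _   = refl
      matching-M (there (here refl)) (there (here refl)) _   _   = refl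
      matching-M (here refl)         (there (here refl)) X∈x X∈y = ⊥-elim (disjoint X∈x X∈y)
      matching-M (there (here refl)) (here refl)         X∈x X∈y = ⊥-elim (disjoint X∈y X∈x)

  disjoint-isMorse : ∀ {a b} → IsArcₐ a → IsArcₐ b → Disjoint a b →
                     IsMorseMatching Δ ⟦ a ∷ b ∷ [] ⟧ ⊎ IsMorseMatching Δ ⟦ b ∷ a ∷ [] ⟧
  disjoint-isMorse {Ga , Ea} {Gb , Eb} a b disjoint with isArc Δ Gb Ea in Gb→Ea
  ... | true  = inj₂ (Pair.isMorse b a (Disjoint-sym disjoint) (no-crossing a b disjoint Gb→Ea))
  ... | false = inj₁ (Pair.isMorse a b disjoint (λ Gb→Ea′ → contradiction (trans (sym Gb→Ea′) Gb→Ea) λ ()))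

  -- Affine independence of incidence vectors

  χₐ : ArcSet n → Arc n → ℚ
  χₐ M = uncurry (χ Δ M)

  χₐ-arc : ∀ {M a} → IsArcₐ a → χₐ M a ≡ indicator (uncurry M a)
  χₐ-arc {M} {G , E} arc = cong (λ b → indicator (b ∧ M G E)) arc

  differences : ∀ {k} → (Fin (suc k) → ArcSet n) → Fin k → Arc n → ℚ
  differences p i a = χₐ (p (suc i)) a - χₐ (p zero) a

  vanishing⇒¬affIndep : ∀ {k} (p : Fin (suc k) → ArcSet n) (L : List (Arc n)) (c : Fin k → ℚ) →
    (∀ {a} → IsArcₐ a → a ∈ L) → (∀ t → combination c (differences p) (lookup L t) ≡ 0ℚ) →
    ∀ j → c j ≢ 0ℚ → ¬ AffIndep Δ k p
  vanishing⇒¬affIndep {k} p L c L-covers vanishes j cⱼ≢0 indep = cⱼ≢0 (indep c vanishes-on-arcs j)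
    where
    vanishes-on-arcs : ∀ G E → IsArc Δ G E → sumFin k (λ i → c i * differences p i (G , E)) ≡ 0ℚ
    vanishes-on-arcs G E arc = begin
      sumFin k (λ i → c i * differences p i (G , E))  ≡⟨ sumFin≡sum k _ ⟩
      combination c (differences p) (G , E)          ≡⟨ cong (combination c (differences p)) (lookup-index (L-covers arc)) ⟩
      combination c (differences p) (lookup L _)     ≡⟨ vanishes _ ⟩
      0ℚ                                             ∎
      where open ≡-Reasoning

  covered⇒¬affIndep : ∀ {k} (L : List (Arc n)) → (∀ {a} → IsArcₐ a → a ∈ L) → length L < k →
                      (p : Fin (suc k) → ArcSet n) → ¬ AffIndep Δ k p
  covered⇒¬affIndep L L-covers |L|<k p with c , vanishes , j , cⱼ≢0 ← dependent (lookup L) (differences p) |L|<k =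
    vanishing⇒¬affIndep p L c L-covers vanishes j cⱼ≢0

  -- On the hyperplane the coordinate x₀ is determined by those in L, so a linear
  -- dependence on the coordinates in L already vanishes everywhere.
  hyperplane⇒¬affIndep : ∀ {k} (x₀ : Arc n) (L : List (Arc n)) (g : Arc n → ℚ) →
    (∀ {a} → IsArcₐ a → a ∈ x₀ ∷ L) → length L < k → (p : Fin (suc k) → ArcSet n) →
    (∀ i → linearForm x₀ (lookup L) (g ∘ lookup L) (χₐ (p i)) ≡ 1ℚ) → ¬ AffIndep Δ k p
  hyperplane⇒¬affIndep x₀ L g covers |L|<k p on-hyperplane
    with c , vanishes , j , cⱼ≢0 ← dependent (lookup L) (differences p) |L|<k =
    vanishing⇒¬affIndep p (x₀ ∷ L) c covers vanishes′ j cⱼ≢0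
    where
    φ : (Arc n → ℚ) → ℚ
    φ = linearForm x₀ (lookup L) (g ∘ lookup L)
    φ-differences : ∀ i → φ (differences p i) ≡ 0ℚ
    φ-differences i = begin
      φ (differences p i)                   ≡⟨ linearForm-sub x₀ (lookup L) (g ∘ lookup L) (χₐ (p (suc i))) (χₐ (p zero)) ⟩
      φ (χₐ (p (suc i))) - φ (χₐ (p zero))  ≡⟨ cong₂ _-_ (on-hyperplane (suc i)) (on-hyperplane zero) ⟩
      1ℚ - 1ℚ                               ≡⟨ ℚ.+-inverseʳ 1ℚ ⟩
      0ℚ                                    ∎
      where open ≡-Reasoning
    w = combination c (differences p)
    vanishes′ : ∀ t → w (lookup (x₀ ∷ L) t) ≡ 0ℚ
    vanishes′ (suc t) = vanishes t
    vanishes′ zero    = begin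
      w x₀                                    ≡⟨ sym (ℚ.+-identityʳ (w x₀)) ⟩
      w x₀ + 0ℚ                               ≡⟨ cong (w x₀ +_) (sym (sum-zeros (λ t → trans (cong (g (lookup L t) *_) (vanishes t))
                                                                                           (ℚ.*-zeroʳ (g (lookup L t)))))) ⟩
      φ w                                     ≡⟨ linearForm-combination x₀ (lookup L) (g ∘ lookup L) c (differences p) ⟩
      ∑[ i < _ ] (c i * φ (differences p i))  ≡⟨ sum-zeros (λ i → trans (cong (c i *_) (φ-differences i)) (ℚ.*-zeroʳ (c i))) ⟩
      0ℚ                                      ∎
      where open ≡-Reasoning

  -- Induction on the rank ρ: an off-diagonal entry can only be nonzero in a column of
  -- higher rank.
  triangular⇒affIndep : ∀ {k} (p : Fin (suc k) → ArcSet n) (y : Fin k → Arc n) (ρ : Fin k → ℕ) →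
    (∀ j → IsArcₐ (y j)) → (∀ j → uncurry (p zero) (y j) ≡ false) → (∀ j → uncurry (p (suc j)) (y j) ≡ true) →
    (∀ {i j} → i ≢ j → uncurry (p (suc i)) (y j) ≡ true → ρ i < ρ j) →
    AffIndep Δ k p
  triangular⇒affIndep {k} p y ρ arc p₀-avoids diagonal below-diagonal c vanishes j =
    rank-below (suc (ρ j)) j ℕ.≤-refl
    where
    entry : ∀ i j → differences p i (y j) ≡ indicator (uncurry (p (suc i)) (y j))
    entry i j = begin
      χₐ (p (suc i)) (y j) - χₐ (p zero) (y j)
        ≡⟨ cong₂ _-_ (χₐ-arc {p (suc i)} (arc j)) (trans (χₐ-arc {p zero} (arc j)) (cong indicator (p₀-avoids j))) ⟩
      indicator (uncurry (p (suc i)) (y j)) - 0ℚ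
        ≡⟨ ℚ.+-identityʳ _ ⟩
      indicator (uncurry (p (suc i)) (y j))
        ∎
      where open ≡-Reasoning
    rank-below : ∀ m j → ρ j < m → c j ≡ 0ℚ
    rank-below (suc m) j ρⱼ<1+m = begin
      c j                                           ≡⟨ sym (ℚ.*-identityʳ (c j)) ⟩
      c j * 1ℚ                                      ≡⟨ cong (c j *_) (trans (cong indicator (sym (diagonal j))) (sym (entry j j))) ⟩
      c j * differences p j (y j)                   ≡⟨ sym (sum-single j off-diagonal) ⟩
      combination c (differences p) (y j)           ≡⟨ sym (sumFin≡sum k _) ⟩
      sumFin k (λ i → c i * differences p i (y j))  ≡⟨ vanishes _ _ (arc j) ⟩
      0ℚ                                            ∎
      where
      open ≡-Reasoning
      off-diagonal : ∀ i → i ≢ j → c i * differences p i (y j) ≡ 0ℚ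
      off-diagonal i i≢j = trans (cong (c i *_) (entry i j)) (by-entry _ refl)
        where
        by-entry : ∀ b → uncurry (p (suc i)) (y j) ≡ b → c i * indicator b ≡ 0ℚ
        by-entry true  pᵢyⱼ = trans (cong (_* 1ℚ) (rank-below m i ρᵢ<m)) (ℚ.*-zeroˡ 1ℚ)
          where ρᵢ<m = ℕ.<-≤-trans (below-diagonal i≢j pᵢyⱼ) (s≤s⁻¹ ρⱼ<1+m)
        by-entry false _    = ℚ.*-zeroʳ (c i)

-- The facet x(δ(F)) ≤ 1

module Facet (Δ : Family n) {F : Subset n} {a₀ a₁ : Arc n} (a₀≢a₁ : a₀ ≢ a₁)
             (arc₀ : Hasse.IsArcₐ Δ a₀) (arc₁ : Hasse.IsArcₐ Δ a₁) (F∈a₀ : F ∈ₐ a₀) (F∈a₁ : F ∈ₐ a₁) where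

  open Hasse Δ

  R : List (Arc n)
  R = proj₁ (extract (∈-arcs⁺ arc₀))

  O : List (Arc n)
  O = a₀ ∷ R

  k : ℕ
  k = length R

  O↭arcs : O ↭ arcs
  O↭arcs = proj₂ (extract (∈-arcs⁺ arc₀))

  O-unique : Unique O
  O-unique = PermutationSetoid.Unique-resp-↭ (setoid (Arc n)) (↭.↭⇒↭ₛ (↭.↭-sym O↭arcs)) arcs-unique

  ∈-O : ∀ {a} → IsArcₐ a → a ∈ O
  ∈-O arc = ∈-resp-↭ (↭.↭-sym O↭arcs) (∈-arcs⁺ arc)

  lookup-O-arc : ∀ i → IsArcₐ (lookup O i)
  lookup-O-arc i = ∈-arcs⁻ (∈-resp-↭ O↭arcs (∈-lookup i))

  polytope-point : Fin (suc (suc k)) → ArcSet n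
  polytope-point zero    = ⟦ [] ⟧
  polytope-point (suc i) = ⟦ lookup O i ∷ [] ⟧

  polytope-point-isMorse : ∀ i → IsMorseMatching Δ (polytope-point i)
  polytope-point-isMorse zero    = ∅-isMorse
  polytope-point-isMorse (suc i) = Singleton.isMorse (lookup-O-arc i)

  polytope-point-affIndep : AffIndep Δ (suc k) polytope-point
  polytope-point-affIndep = triangular⇒affIndep polytope-point (lookup O) (λ _ → 0) lookup-O-arc (λ _ → refl)
    (λ j → ⟦⟧-true⁺ {L = lookup O j ∷ []} (here refl))
    (λ {i} {j} i≢j m → contradiction (lookup-injective O-unique (sym (singleton⁻ (⟦⟧-true⁻ (lookup O j) m)))) i≢j)
    where
    singleton⁻ : ∀ {x y : Arc n} → x ∈ y ∷ [] → x ≡ y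
    singleton⁻ (here x≡y) = x≡y

  polytope-dimension : HasAffDim Δ (IsMorseMatching Δ) (suc k)
  polytope-dimension =
    (polytope-point , polytope-point-isMorse , polytope-point-affIndep) , λ p _ → covered⇒¬affIndep O ∈-O ℕ.≤-refl p

  -- A Morse matching on the facet for each arc r; the last two fields make the incidence
  -- matrix of these matchings triangular.
  record FacetMatching (r : Arc n) : Set where
    field
      matching              : List (Arc n)
      isMorse               : IsMorseMatching Δ ⟦ matching ⟧
      tight                 : incCount Δ ⟦ matching ⟧ F ≡ 1
      ∋r                    : r ∈ matching
      others-incident       : ∀ {y} → y ∈ matching → y ≢ r → F ∈ₐ y
      singleton-if-incident : F ∈ₐ r → ∀ {y} → y ∈ matching → y ≡ r

  singletonMatching : ∀ {r} → IsArcₐ r → F ∈ₐ r → FacetMatching r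
  singletonMatching {r} arc F∈r = record
    { matching              = r ∷ []
    ; isMorse               = Singleton.isMorse arc
    ; tight                 = countPairs-≡1 _ (matchedAt⁺ {⟦ r ∷ [] ⟧} {F} {r} arc r∈ F∈r) only-r
    ; ∋r                    = here refl
    ; others-incident       = λ { (here refl) r≢r → contradiction refl r≢r }
    ; singleton-if-incident = λ { _ (here refl) → refl }
    }
    where
    r∈ = ⟦⟧-true⁺ {L = r ∷ []} (here refl)
    only-r : ∀ {y} → matchedAt ⟦ r ∷ [] ⟧ F y ≡ true → y ≡ r
    only-r {y} py with _ , m , _ ← matchedAt⁻ {⟦ r ∷ [] ⟧} {F} y py with here refl ← ⟦⟧-true⁻ {L = r ∷ []} y m =
      refl

  pairMatching : ∀ {a r} L → IsMorseMatching Δ ⟦ L ⟧ → IsArcₐ a → F ∈ₐ a → ¬ F ∈ₐ r →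
              a ∈ L → r ∈ L → (∀ {y} → y ∈ L → y ≡ a ⊎ y ≡ r) → FacetMatching r
  pairMatching {a} {r} L isMorse arc F∈a F∉r a∈L r∈L L⊆ar = record
    { matching              = L
    ; isMorse               = isMorse
    ; tight                 = countPairs-≡1 _ (matchedAt⁺ {⟦ L ⟧} {F} {a} arc (⟦⟧-true⁺ {L = L} a∈L) F∈a) only-a
    ; ∋r                    = r∈L
    ; others-incident       = others-incident
    ; singleton-if-incident = λ F∈r → contradiction F∈r F∉r
    }
    where
    only-a : ∀ {y} → matchedAt ⟦ L ⟧ F y ≡ true → y ≡ a
    only-a {y} py with _ , m , F∈y ← matchedAt⁻ {⟦ L ⟧} {F} y py with L⊆ar (⟦⟧-true⁻ y m)
    ... | inj₁ y≡a  = y≡a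
    ... | inj₂ refl = contradiction F∈y F∉r
    others-incident : ∀ {y} → y ∈ L → y ≢ r → F ∈ₐ y
    others-incident y∈L y≢r with L⊆ar y∈L
    ... | inj₁ refl = F∈a
    ... | inj₂ y≡r  = contradiction y≡r y≢r

  disjointMatching : ∀ {a r} → IsArcₐ a → IsArcₐ r → F ∈ₐ a → ¬ F ∈ₐ r → Disjoint a r → FacetMatching r
  disjointMatching {a} {r} arcᵃ arcʳ F∈a F∉r disjoint with disjoint-isMorse arcᵃ arcʳ disjoint
  ... | inj₁ isMorse = pairMatching (a ∷ r ∷ []) isMorse arcᵃ F∈a F∉r (here refl) (there (here refl)) λ where
    (here refl)         → inj₁ refl
    (there (here refl)) → inj₂ refl
  ... | inj₂ isMorse = pairMatching (r ∷ a ∷ []) isMorse arcᵃ F∈a F∉r (there (here refl)) (here refl) λ where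
    (here refl)         → inj₂ refl
    (there (here refl)) → inj₁ refl

  facetMatching : ∀ {r} → IsArcₐ r → FacetMatching r
  facetMatching {r} arc with F ∈ₐ? r
  ... | yes F∈r = singletonMatching arc F∈r
  ... | no F∉r with some-disjoint a₀≢a₁ arc₀ arc₁ arc F∈a₀ F∈a₁ F∉r
  ...   | inj₁ disjoint = disjointMatching arc₀ arc F∈a₀ F∉r disjoint
  ...   | inj₂ disjoint = disjointMatching arc₁ arc F∈a₁ F∉r disjoint

  facet-point : Fin (suc k) → ArcSet n
  facet-point i = ⟦ FacetMatching.matching (facetMatching (lookup-O-arc i)) ⟧

  facet-point-tight : ∀ i → IsMorseMatching Δ (facet-point i) × incCount Δ (facet-point i) F ≡ 1
  facet-point-tight i = isMorse , tight
    where open FacetMatching (facetMatching (lookup-O-arc i))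

  rank : Fin k → ℕ
  rank j = bit (isYes (F ∈ₐ? lookup R j))

  rank-< : ∀ {i j} → ¬ F ∈ₐ lookup R i → F ∈ₐ lookup R j → rank i < rank j
  rank-< {i} {j} F∉Rᵢ F∈Rⱼ
    rewrite isYes-false⁺ (F ∈ₐ? lookup R i) F∉Rᵢ | isYes-true⁺ (F ∈ₐ? lookup R j) F∈Rⱼ = s≤s z≤n

  facet-affIndep : AffIndep Δ k facet-point
  facet-affIndep = triangular⇒affIndep facet-point (lookup R) rank (lookup-O-arc ∘ suc) avoids diagonal below-diagonal
    where
    open FacetMatching
    matchingAt : ∀ i → FacetMatching (lookup O i)
    matchingAt i = facetMatching (lookup-O-arc i)
    avoids : ∀ j → uncurry (facet-point zero) (lookup R j) ≡ false
    avoids j = ⟦⟧-false⁺ {L = matching (matchingAt zero)} λ Rⱼ∈ →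
      contradiction (lookup-injective O-unique {suc j} {zero} (singleton-if-incident (matchingAt zero) F∈a₀ Rⱼ∈)) λ ()
    diagonal : ∀ j → uncurry (facet-point (suc j)) (lookup R j) ≡ true
    diagonal j = ⟦⟧-true⁺ {L = matching (matchingAt (suc j))} (∋r (matchingAt (suc j)))
    below-diagonal : ∀ {i j} → i ≢ j → uncurry (facet-point (suc i)) (lookup R j) ≡ true → rank i < rank j
    below-diagonal {i} {j} i≢j m = rank-< F∉Rᵢ F∈Rⱼ
      where
      Rⱼ∈ = ⟦⟧-true⁻ {L = matching (matchingAt (suc i))} (lookup R j) m
      Rⱼ≢Rᵢ : lookup R j ≢ lookup R i
      Rⱼ≢Rᵢ eq = i≢j (suc-injective (lookup-injective O-unique (sym eq)))
      F∈Rⱼ = others-incident (matchingAt (suc i)) Rⱼ∈ Rⱼ≢Rᵢ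
      F∉Rᵢ = λ F∈Rᵢ → Rⱼ≢Rᵢ (singleton-if-incident (matchingAt (suc i)) F∈Rᵢ Rⱼ∈)

  incidence-weight : Arc n → ℚ
  incidence-weight = indicator ∘ uncurry (incident F)

  -- x(δ(F)) = 1 with the summand of a₀ singled out.
  tight⇒on-hyperplane : ∀ M → incCount Δ M F ≡ 1 →
                        linearForm a₀ (lookup R) (incidence-weight ∘ lookup R) (χₐ M) ≡ 1ℚ
  tight⇒on-hyperplane M tight = begin
    χₐ M a₀ + ∑[ t < k ] (incidence-weight (lookup R t) * χₐ M (lookup R t))
      ≡⟨ cong₂ _+_ (sym a₀-summand) (sum-cong-≗ (λ t → sym (summand (lookup R t)))) ⟩
    ∑[ t < suc k ] indicator (matchedAt M F (lookup O t))
      ≡⟨ count-∑ (matchedAt M F) O ⟩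
    count (matchedAt M F) O ×ℚ 1ℚ
      ≡⟨ cong (_×ℚ 1ℚ) (count-↭ (matchedAt M F) O↭arcs) ⟩
    count (matchedAt M F) arcs ×ℚ 1ℚ
      ≡⟨ cong (_×ℚ 1ℚ) (sym (countPairs≡count-arcs _ (λ {G} {E} h → proj₁ (∧-true⁻ (isArc Δ G E) h)))) ⟩
    incCount Δ M F ×ℚ 1ℚ
      ≡⟨ cong (_×ℚ 1ℚ) tight ⟩
    1ℚ
      ∎
    where
    open ≡-Reasoning
    summand : ∀ a → indicator (matchedAt M F a) ≡ incidence-weight a * χₐ M a
    summand a = indicator-∧∧ (uncurry (isArc Δ) a) (uncurry M a) (uncurry (incident F) a)
    a₀-summand : indicator (matchedAt M F a₀) ≡ χₐ M a₀
    a₀-summand =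
      trans (summand a₀) (trans (cong (λ b → indicator b * χₐ M a₀) (∈ₐ⇒incident F∈a₀)) (ℚ.*-identityˡ _))

  facet-dimension : HasAffDim Δ (λ M → IsMorseMatching Δ M × incCount Δ M F ≡ 1) k
  facet-dimension = (facet-point , facet-point-tight , facet-affIndep) , λ p on-facet →
    hyperplane⇒¬affIndep a₀ R incidence-weight ∈-O ℕ.≤-refl p (λ i → tight⇒on-hyperplane (p i) (proj₂ (on-facet i)))

-- The construction works for any family of faces: only Δ F and the degree bound are used.
proposition5p2 : (n : ℕ) (Δ : Family n) → IsSimplicialComplex Δ → Connected Δ → DimAtLeast1 Δ →
    (F : Subset n) → Δ F ≡ true → 2 ≤ degree Δ F → DefinesFacet Δ F
proposition5p2 n Δ _ _ _ F ΔF 2≤deg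
  with a₀ , a₁ , a₀≢a₁ , (arc₀ , F∈a₀) , (arc₁ , F∈a₁) ← Hasse.two-incident-arcs Δ 2≤deg =
  (λ M isMorse → proj₂ (proj₁ isMorse) F ΔF) , k , polytope-dimension , facet-dimension
  where open Facet Δ a₀≢a₁ arc₀ arc₁ F∈a₀ F∈a₁
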